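{- Let $m \ge 1$ be an integer and $a$ an indeterminate. For every nonnegative integer $n$, $$\sum_{\lambda \in A_m(n)} \omega_1(\lambda) = \sum_{\mu \in B_m(n)} \omega_2(\mu),$$ where for $\lambda = (\lambda_1, \ldots, \lambda_l) \in A_m(n)$ we set $\omega_1(\lambda) = (-1)^{l-1} a^{\ell_o(\lambda)}$, and for $\mu = (\mu_1, \ldots, \mu_l) \in B_m(n)$ we set $\omega_2(\mu) = (-a)^l$.
   Context: $A_m(n)$ is the set of nonempty strictly decreasing finite sequences $\lambda = (\lambda_1 > \cdots > \lambda_l)$ of nonnegative integers (so $0$ may occur as a part, at most once) with sum $n$, such that every even part is a multiple of $2m$ (this includes the part $0$) and the smallest part $\lambda_l$ is even. $B_m(n)$ is the set of partitions $\mu = (\mu_1 > \mu_2 > \cdots > \mu_l)$ of $n$ into $l \ge 0$ distinct odd positive parts such that $\mu_i - \mu_{i+1} \le 2m$ for all $1 \le i \le l$, with the convention $\mu_{l+1} = 0$ (the empty partition belongs to $B_m(0)$). In both cases $l$ is the number of parts (a part $0$ counts as a part), and $\ell_o(\lambda)$ is the number of odd parts of $\lambda$. -}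

module Defs where

open import Level using (Level)
open import Algebra.Bundles using (CommutativeRing)
open import Data.Nat using (ℕ; zero; suc; _∸_; _*_; _≤_; _<_)
open import Data.Nat.Divisibility using (_∣_; _∣?_)
open import Data.List using (List; []; _∷_; _∷ʳ_; length; filter; map; foldr)
open import Data.Nat.ListAction using (sum)
open import Data.List.Relation.Unary.All using (All)
open import Data.List.Relation.Unary.Linked using (Linked)
open import Data.List.Relation.Unary.Unique.Propositional using (Unique)
open import Data.List.Membership.Propositional using (_∈_)
open import Data.Product using (Σ; _×_)
open import Relation.Nullary using (¬_; ¬?)
open import Relation.Binary.PropositionalEquality using (_≡_)
open import Function.Bundles using (_⇔_)

StrictDec : List ℕ → Set
StrictDec = Linked (λ x y → y < x)

Even Odd : ℕ → Set
Even x = 2 ∣ x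
Odd x = ¬ (2 ∣ x)

ℓₒ : List ℕ → ℕ
ℓₒ xs = length (filter (λ x → ¬? (2 ∣? x)) xs)

-- Nonemptiness is built into the decomposition λ = ys ∷ʳ k.
record InA (m n : ℕ) (λs : List ℕ) : Set where
  field
    strict   : StrictDec λs
    sumIs    : sum λs ≡ n
    evenMult : All (λ x → Even x → (2 * m) ∣ x) λs
    init     : List ℕ
    smallest : ℕ
    split    : λs ≡ init ∷ʳ smallest
    smallestEven : Even smallest

-- μ ∈ B_m(n): distinct odd positive parts (odd parts are positive; strict
-- decrease gives distinctness), sum n, and μᵢ - μᵢ₊₁ ≤ 2m for 1 ≤ i ≤ l with
-- μ_{l+1} = 0, expressed on the list μ with 0 appended.
record InB (m n : ℕ) (μs : List ℕ) : Set where
  field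
    strict : StrictDec μs
    odd    : All Odd μs
    sumIs  : sum μs ≡ n
    gaps   : Linked (λ x y → x ∸ y ≤ 2 * m) (μs ∷ʳ 0)

Enumerates : (List ℕ → Set) → List (List ℕ) → Set
Enumerates P L = Unique L × (∀ xs → (xs ∈ L) ⇔ P xs)

module _ {c ℓ : Level} (R : CommutativeRing c ℓ) where
  open CommutativeRing R using (Carrier; 1#; 0#; -_) renaming (_*_ to _·_; _+_ to _⊕_)

  pow : Carrier → ℕ → Carrier
  pow x zero = 1#
  pow x (suc k) = x · pow x k

  ΣR : List Carrier → Carrier
  ΣR = foldr _⊕_ 0#

  ω₁ : Carrier → List ℕ → Carrier
  ω₁ a λs = pow (- 1#) (length λs ∸ 1) · pow a (ℓₒ λs)

  ω₂ : Carrier → List ℕ → Carrier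
  ω₂ a μs = pow (- a) (length μs)

module Submission where

-- Split a partition λ ∈ A_m(n) into its odd parts O and its even parts E (multiples of 2m,
-- the smallest one below every odd part).  An involution φ on A_m(n) is built from two moves:
-- if the smallest positive even part lies below all odd parts, insert or delete the part 0;
-- otherwise scan the odd parts upwards and, at the first place where it is possible, either
-- split off from an odd part whose gap to its predecessor exceeds 2m the largest multiple of
-- 2m below that gap, or absorb the smallest even part into an odd part.  φ keeps ℓₒ and
-- changes the number of parts by one, hence flips the sign of ω₁, except at its fixed points:
-- these are exactly μ ∪ {0} with μ ∈ B_m(n) (all gaps at most 2m, no positive even part),
-- where ω₁(μ ∪ {0}) = (-1)^l a^l = ω₂(μ).  The other terms cancel in pairs.

open import Defs
open import Algebra.Bundles using (CommutativeRing)
open import Data.Empty using (⊥; ⊥-elim)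
open import Data.List using (List; []; _∷_; _∷ʳ_; _++_; length; map; filter; reverse; reverseAcc; merge)
open import Data.List.Properties
  using (length-filter; length-++; length-reverse; filter-accept; filter-reject; filter-all; filter-none; filter-++;
         ++-identityʳ; map-∘; reverse-involutive; reverse-++; unfold-reverse; ≡-dec; ∷ʳ-injectiveˡ)
open import Data.List.Membership.Propositional using (_∈_)
open import Data.List.Membership.Propositional.Properties using (∈-filter⁺; ∈-filter⁻; ∈-map⁺; ∈-map⁻)
open import Data.List.Membership.Propositional.Properties.WithK using (unique∧set⇒bag)
open import Data.List.Relation.Binary.BagAndSetEquality using (∼bag⇒↭)
open import Data.List.Relation.Binary.Equality.Propositional using (≋⇒≡)
open import Data.List.Relation.Binary.Permutation.Propositional
  using (_↭_; ↭-refl; ↭-sym; ↭-trans; ↭-prep; ↭-reflexive; ↭⇒↭ₛ; ↭⇒↭ₛ′)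
open import Data.List.Relation.Binary.Permutation.Propositional.Properties as ↭
  using (merge-↭; shift; filter-↭; All-resp-↭; ↭-reverse; ↭-length)
import Data.List.Relation.Binary.Permutation.Setoid.Properties as ↭ₛ
open import Data.List.Relation.Unary.All as All using (All; []; _∷_)
import Data.List.Relation.Unary.All.Properties as All
open import Data.List.Relation.Unary.AllPairs as AllPairs using (AllPairs; []; _∷_)
import Data.List.Relation.Unary.AllPairs.Properties as AllPairs
open import Data.List.Relation.Unary.Any using (here; there)
open import Data.List.Relation.Unary.Linked as Linked using (Linked; []; [-]; _∷_)
open import Data.List.Relation.Unary.Linked.Properties using (AllPairs⇒Linked; Linked⇒AllPairs)
import Data.List.Relation.Unary.Sorted.TotalOrder.Properties as Sorted
open import Data.List.Relation.Unary.Unique.Propositional using (Unique)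
import Data.List.Relation.Unary.Unique.Propositional.Properties as Unique
open import Data.Nat using (ℕ; zero; suc; _+_; _*_; _∸_; _/_; _%_; _≤_; _<_; _<?_; z≤n; s≤s; z<s)
open import Data.Nat.DivMod using (m≡m%n+[m/n]*n; m/n*n≤m; m%n<n; +-distrib-/-∣ʳ; m<n⇒m/n≡0; m/n*n≡m)
open import Data.Nat.Divisibility
  using (_∣_; _∣?_; _∣0; divides; ∣⇒≤; n∣m*n; m∣m*n; ∣-trans; ∣m+n∣m⇒∣n; ∣m∣n⇒∣m+n)
open import Data.Nat.ListAction using (sum)
open import Data.Nat.ListAction.Properties using (sum-↭; sum-++)
open import Data.Nat.Properties
  using (module ≤-Reasoning; _≟_; _≤?_; ≤-refl; ≤-trans; <-trans; <-≤-trans; ≤-totalOrder; ≤-decTotalOrder;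
         <⇒≤; <⇒≢; <⇒≱; ≤⇒≯; ≮⇒≥; ≤∧≢⇒<; n≢0⇒n>0; 1+n≢n; +-comm; +-suc; +-mono-≤; +-monoˡ-≤; +-monoˡ-<;
         +-cancelˡ-<; *-monoˡ-≤; *-cancelʳ-<; m≤m+n; m≤n+m; m<m+n; m<n⇒0<n∸m; m∸n≤m; m∸n+n≡m;
         m+n∸n≡m; m+n∸m≡n; m+[n∸m]≡n; +-∸-comm)
import Data.Nat.Properties as ℕ
open import Data.List.Relation.Unary.Sorted.TotalOrder ≤-totalOrder using (Sorted)
open import Data.Nat.Tactic.RingSolver using (solve-∀)
open import Data.Product using (Σ-syntax; _×_; _,_; proj₁; proj₂; map₁; map₂; uncurry)
open import Data.Sum using (_⊎_; inj₁; inj₂)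
open import Data.Unit using (⊤; tt)
open import Function using (flip; _∘_)
open import Function.Bundles using (Equivalence; mk⇔)
open import Relation.Binary using (Rel; DecidableEquality) renaming (Decidable to Decidable₂)
open import Relation.Binary.PropositionalEquality as ≡
  using (_≡_; _≢_; refl; sym; trans; cong; cong₂; subst; subst₂; module ≡-Reasoning)
open import Relation.Nullary using (¬_; ¬?; Dec; yes; no)
open import Relation.Unary using (Pred; Decidable)

module _ {a r} {A : Set a} {R : Rel A r} where

  Linked-reverseAcc⁺ : ∀ {x acc ys} → Linked (flip R) (x ∷ acc) → Linked R (x ∷ ys) →
                       Linked (flip R) (reverseAcc (x ∷ acc) ys)
  Linked-reverseAcc⁺ racc [-]       = racc
  Linked-reverseAcc⁺ racc (rxy ∷ r) = Linked-reverseAcc⁺ (rxy ∷ racc) r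

  Linked-reverse⁺ : ∀ {xs} → Linked R xs → Linked (flip R) (reverse xs)
  Linked-reverse⁺ {[]}    _ = []
  Linked-reverse⁺ {_ ∷ _} r = Linked-reverseAcc⁺ [-] r

All-reverse⁺ : ∀ {a p} {A : Set a} {P : Pred A p} {xs} → All P xs → All P (reverse xs)
All-reverse⁺ {xs = xs} = All-resp-↭ (↭-sym (↭-reverse xs))

reverse-∷ʳ : ∀ {a} {A : Set a} (xs : List A) x → reverse (xs ∷ʳ x) ≡ x ∷ reverse xs
reverse-∷ʳ xs x = reverse-++ xs (x ∷ [])

merge-reject : ∀ {a r} {A : Set a} {R : Rel A r} (R? : Decidable₂ R) {x y xs ys} →
               ¬ R x y → merge R? (x ∷ xs) (y ∷ ys) ≡ y ∷ merge R? (x ∷ xs) ys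
merge-reject R? {x} {y} ¬r with R? x y
... | yes r = ⊥-elim (¬r r)
... | no _  = refl

m+n+o≡o+m+n : ∀ m n o → m + n + o ≡ o + m + n
m+n+o≡o+m+n = solve-∀

m+o+[n+p]≡m+n+o+p : ∀ m n o p → m + o + (n + p) ≡ m + n + o + p
m+o+[n+p]≡m+n+o+p = solve-∀

m∸n≤o⇒m≤o+n : ∀ {m n o} → n ≤ m → m ∸ n ≤ o → m ≤ o + n
m∸n≤o⇒m≤o+n n≤m m∸n≤o = subst (_≤ _) (m∸n+n≡m n≤m) (+-monoˡ-≤ _ m∸n≤o)

Adjacent : ℕ → ℕ → Set
Adjacent x y = y ≡ suc x ⊎ x ≡ suc y

Adjacent-irrefl : ∀ {x} → ¬ Adjacent x x
Adjacent-irrefl (inj₁ eq) = 1+n≢n (sym eq)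
Adjacent-irrefl (inj₂ eq) = 1+n≢n (sym eq)

Adjacent-+ : ∀ z {x y} → Adjacent x y → Adjacent (z + x) (z + y)
Adjacent-+ z {x} (inj₁ eq) = inj₁ (trans (cong (z +_) eq) (+-suc z x))
Adjacent-+ z {_} {y} (inj₂ eq) = inj₂ (trans (cong (z +_) eq) (+-suc z y))

module _ {c ℓ} (R : CommutativeRing c ℓ) where
  open CommutativeRing R renaming (_+_ to _⊕_; refl to ≈-refl)

  ΣR-↭ : ∀ {xs ys} → xs ↭ ys → ΣR R xs ≈ ΣR R ys
  ΣR-↭ p = ↭ₛ.foldr-commMonoid setoid +-isCommutativeMonoid (↭⇒↭ₛ′ isEquivalence p)

  ΣR-map-cong : ∀ {a} {A : Set a} {f g : A → Carrier} xs → (∀ {x} → x ∈ xs → f x ≈ g x) →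
                ΣR R (map f xs) ≈ ΣR R (map g xs)
  ΣR-map-cong []       _   = ≈-refl
  ΣR-map-cong (x ∷ xs) f≈g = +-cong (f≈g (here refl)) (ΣR-map-cong xs (f≈g ∘ there))

module SignReversingInvolution {c ℓ} (R : CommutativeRing c ℓ)
  {a p} {A : Set a} (_≟_ : DecidableEquality A) (P : Pred A p)
  (φ : A → A) (w : A → CommutativeRing.Carrier R)
  (φ-involutive : ∀ {x} → P x → φ (φ x) ≡ x)
  (φ-signReversing : ∀ {x} → P x → φ x ≢ x →
                     CommutativeRing._≈_ R (w (φ x)) (CommutativeRing.-_ R (w x)))
  where

  open CommutativeRing R renaming (_+_ to _⊕_; refl to ≈-refl; sym to ≈-sym; trans to ≈-trans)
  open import Relation.Binary.Reasoning.Setoid setoid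
  open import Algebra.Properties.CommutativeSemigroup +-commutativeSemigroup using (x∙yz≈y∙xz)

  Σw : List A → Carrier
  Σw xs = ΣR R (map w xs)

  fixed? : ∀ x → Dec (φ x ≡ x)
  fixed? x = φ x ≟ x

  moved? : ∀ x → Dec (φ x ≢ x)
  moved? x = ¬? (fixed? x)

  Σw-partition : ∀ xs → Σw xs ≈ Σw (filter fixed? xs) ⊕ Σw (filter moved? xs)
  Σw-partition [] = ≈-sym (+-identityˡ 0#)
  Σw-partition (x ∷ xs) with fixed? x
  ... | yes _ = ≈-trans (+-congˡ (Σw-partition xs)) (≈-sym (+-assoc _ _ _))
  ... | no _  = ≈-trans (+-congˡ (Σw-partition xs)) (x∙yz≈y∙xz _ _ _)

  Σw-remove : ∀ {x xs} → Unique xs → x ∈ xs → Σw xs ≈ w x ⊕ Σw (filter (λ y → ¬? (y ≟ x)) xs)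
  Σw-remove {x} {y ∷ ys} (y∉ys ∷ u) x∈ with y ≟ x | x∈
  ... | yes refl | _ = +-congˡ (reflexive (cong Σw (sym (filter-all _ (All.map (_∘ sym) y∉ys)))))
  ... | no y≢x | here x≡y = ⊥-elim (y≢x (sym x≡y))
  ... | no _   | there x∈ys = ≈-trans (+-congˡ (Σw-remove u x∈ys)) (x∙yz≈y∙xz _ _ _)

  φ-swap : ∀ {x y} → P y → φ y ≡ x → y ≡ φ x
  φ-swap Py φy≡x = trans (sym (φ-involutive Py)) (cong φ φy≡x)

  -- Each x is cancelled by its partner φ x, which is removed along with it.
  Σw-moved : ∀ n {xs} → length xs ≤ n → Unique xs → (∀ {x} → x ∈ xs → P x) →
             (∀ {x} → x ∈ xs → φ x ∈ xs) → (∀ {x} → x ∈ xs → φ x ≢ x) → Σw xs ≈ 0#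
  Σw-moved _ {[]} _ _ _ _ _ = ≈-refl
  Σw-moved (suc n) {x ∷ xs} (s≤s len) (x∉xs ∷ u) inP closed moved = begin
      w x ⊕ Σw xs                ≈⟨ +-congˡ (Σw-remove u φx∈xs) ⟩
      w x ⊕ (w (φ x) ⊕ Σw rest)  ≈⟨ +-assoc _ _ _ ⟨
      (w x ⊕ w (φ x)) ⊕ Σw rest  ≈⟨ +-congʳ cancel ⟩
      0# ⊕ Σw rest               ≈⟨ +-identityˡ _ ⟩
      Σw rest                    ≈⟨ Σw-moved n (≤-trans (length-filter _ xs) len) (Unique.filter⁺ _ u)
                                      (inP ∘ there ∘ in-xs) rest-closed (moved ∘ there ∘ in-xs) ⟩
      0#                         ∎
    where
    Px : P x
    Px = inP (here refl)
    cancel : w x ⊕ w (φ x) ≈ 0#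
    cancel = ≈-trans (+-congˡ (φ-signReversing Px (moved (here refl)))) (-‿inverseʳ _)
    φx∈xs : φ x ∈ xs
    φx∈xs with closed (here refl)
    ... | here φx≡x = ⊥-elim (moved (here refl) φx≡x)
    ... | there φx∈ = φx∈
    rest : List A
    rest = filter (λ y → ¬? (y ≟ φ x)) xs
    in-xs : ∀ {y} → y ∈ rest → y ∈ xs
    in-xs = proj₁ ∘ ∈-filter⁻ _ {xs = xs}
    rest-closed : ∀ {y} → y ∈ rest → φ y ∈ rest
    rest-closed {y} y∈ with ∈-filter⁻ _ {xs = xs} y∈
    ... | y∈xs , y≢φx with closed (there y∈xs)
    ...   | here φy≡x   = ⊥-elim (y≢φx (φ-swap (inP (there y∈xs)) φy≡x))
    ...   | there φy∈xs = ∈-filter⁺ _ φy∈xs λ φy≡φx →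
              All.lookup x∉xs y∈xs (sym (trans (φ-swap (inP (there y∈xs)) φy≡φx) (φ-involutive Px)))

  Σw-fixedPoints : ∀ {xs} → Unique xs → (∀ {x} → x ∈ xs → P x) →
                   (∀ {x} → x ∈ xs → φ x ∈ xs) → Σw xs ≈ Σw (filter fixed? xs)
  Σw-fixedPoints {xs} u inP closed = begin
      Σw xs                                          ≈⟨ Σw-partition xs ⟩
      Σw (filter fixed? xs) ⊕ Σw (filter moved? xs)  ≈⟨ +-congˡ (Σw-moved _ ≤-refl (Unique.filter⁺ _ u)
                                                                  (inP ∘ in-xs) closed′ moved) ⟩
      Σw (filter fixed? xs) ⊕ 0#                     ≈⟨ +-identityʳ _ ⟩
      Σw (filter fixed? xs)                          ∎
    where
    in-xs : ∀ {x} → x ∈ filter moved? xs → x ∈ xs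
    in-xs = proj₁ ∘ ∈-filter⁻ _ {xs = xs}
    moved : ∀ {x} → x ∈ filter moved? xs → φ x ≢ x
    moved = proj₂ ∘ ∈-filter⁻ _ {xs = xs}
    closed′ : ∀ {x} → x ∈ filter moved? xs → φ x ∈ filter moved? xs
    closed′ x∈ = ∈-filter⁺ _ (closed (in-xs x∈)) λ φφx≡φx →
      moved x∈ (sym (trans (sym (φ-involutive (inP (in-xs x∈)))) φφx≡φx))

Ascending : List ℕ → Set
Ascending = AllPairs _<_

odd? : Decidable Odd
odd? x = ¬? (2 ∣? x)

even? : Decidable Even
even? x = 2 ∣? x

odds evens : List ℕ → List ℕ
odds  = filter odd?
evens = filter even?

combine : List ℕ → List ℕ → List ℕ
combine = merge _≤?_

odd⇒positive : ∀ {x} → Odd x → 0 < x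
odd⇒positive {zero}  odd = ⊥-elim (odd (2 ∣0))
odd⇒positive {suc _} _   = z<s

StrictDec⇒Ascending-reverse : ∀ {xs} → StrictDec xs → Ascending (reverse xs)
StrictDec⇒Ascending-reverse = Linked⇒AllPairs <-trans ∘ Linked-reverse⁺

Ascending⇒StrictDec-reverse : ∀ {xs} → Ascending xs → StrictDec (reverse xs)
Ascending⇒StrictDec-reverse = Linked-reverse⁺ ∘ AllPairs⇒Linked

Ascending⇒Sorted : ∀ {xs} → Ascending xs → Sorted xs
Ascending⇒Sorted = Linked.map <⇒≤ ∘ AllPairs⇒Linked

Sorted∧Unique⇒Ascending : ∀ {xs} → Sorted xs → Unique xs → Ascending xs
Sorted∧Unique⇒Ascending s u =
  AllPairs.zipWith (λ (x≤y , x≢y) → ≤∧≢⇒< x≤y x≢y) (Linked⇒AllPairs ≤-trans s , u)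

↗↭↗⇒≡ : ∀ {xs ys} → Sorted xs → Sorted ys → xs ↭ ys → xs ≡ ys
↗↭↗⇒≡ s t p = ≋⇒≡ (Sorted.↗↭↗⇒≋ ≤-totalOrder s t (↭⇒↭ₛ p))

odds++evens-↭ : ∀ xs → odds xs ++ evens xs ↭ xs
odds++evens-↭ [] = ↭-refl
odds++evens-↭ (x ∷ xs) with even? x
... | yes e rewrite filter-reject odd? {xs = xs} (λ o → o e) | filter-accept even? {xs = xs} e =
  ↭-trans (shift x (odds xs) (evens xs)) (↭-prep x (odds++evens-↭ xs))
... | no o rewrite filter-accept odd? {xs = xs} o | filter-reject even? {xs = xs} o =
  ↭-prep x (odds++evens-↭ xs)

module _ {O E : List ℕ} (odd : All Odd O) (even : All Even E) where

  odds-↭ : ∀ {xs} → xs ↭ O ++ E → odds xs ↭ O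
  odds-↭ {xs} p = ↭-trans (filter-↭ _ p) (↭-reflexive (begin
      odds (O ++ E)       ≡⟨ filter-++ _ O E ⟩
      odds O ++ odds E    ≡⟨ cong₂ _++_ (filter-all _ odd) (filter-none _ (All.map (λ e o → o e) even)) ⟩
      O ++ []             ≡⟨ ++-identityʳ O ⟩
      O ∎))
    where open ≡-Reasoning

  evens-↭ : ∀ {xs} → xs ↭ O ++ E → evens xs ↭ E
  evens-↭ {xs} p = ↭-trans (filter-↭ _ p)
    (↭-reflexive (trans (filter-++ _ O E) (cong₂ _++_ (filter-none _ odd) (filter-all _ even))))

  combine-sorted : Ascending O → Ascending E → Sorted (combine O E)
  combine-sorted aO aE = Sorted.merge⁺ ≤-decTotalOrder (Ascending⇒Sorted aO) (Ascending⇒Sorted aE)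

  combine-ascending : Ascending O → Ascending E → Ascending (combine O E)
  combine-ascending aO aE = Sorted∧Unique⇒Ascending (combine-sorted aO aE)
    (↭ₛ.Unique-resp-↭ (≡.setoid ℕ) (↭⇒↭ₛ (↭-sym (merge-↭ _≤?_ O E)))
      (Unique.++⁺ (AllPairs.map <⇒≢ aO) (AllPairs.map <⇒≢ aE)
        λ (v∈O , v∈E) → All.lookup odd v∈O (All.lookup even v∈E)))

  odds-combine : Ascending O → Ascending E → odds (combine O E) ≡ O
  odds-combine aO aE = ↗↭↗⇒≡ (Sorted.filter⁺ ≤-totalOrder _ (combine-sorted aO aE)) (Ascending⇒Sorted aO)
    (odds-↭ (merge-↭ _≤?_ O E))

  evens-combine : Ascending O → Ascending E → evens (combine O E) ≡ E
  evens-combine aO aE = ↗↭↗⇒≡ (Sorted.filter⁺ ≤-totalOrder _ (combine-sorted aO aE)) (Ascending⇒Sorted aE)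
    (evens-↭ (merge-↭ _≤?_ O E))

combine-odds-evens : ∀ {xs} → Ascending xs → combine (odds xs) (evens xs) ≡ xs
combine-odds-evens {xs} a = ↗↭↗⇒≡
  (Sorted.merge⁺ ≤-decTotalOrder (Sorted.filter⁺ ≤-totalOrder _ s) (Sorted.filter⁺ ≤-totalOrder _ s)) s
  (↭-trans (merge-↭ _≤?_ (odds xs) (evens xs)) (odds++evens-↭ xs))
  where
  s : Sorted xs
  s = Ascending⇒Sorted a

combine-[]ʳ : ∀ O → combine O [] ≡ O
combine-[]ʳ []      = refl
combine-[]ʳ (_ ∷ _) = refl

combine-∷ʳ : ∀ {e O} E → All (e <_) O → combine O (e ∷ E) ≡ e ∷ combine O E
combine-∷ʳ {O = []}    E _ = refl
combine-∷ʳ {e} {o ∷ O} E (e<o ∷ _) = merge-reject _≤?_ {xs = O} {ys = E} (<⇒≱ e<o)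

length-combine : ∀ O E → length (combine O E) ≡ length O + length E
length-combine O E = trans (↭-length (merge-↭ _≤?_ O E)) (length-++ O)

infix 4 _<Head_ _<Head?_

_<Head_ : ℕ → List ℕ → Set
x <Head []      = ⊤
x <Head (y ∷ _) = x < y

_<Head?_ : ∀ x ys → Dec (x <Head ys)
x <Head? []      = yes tt
x <Head? (y ∷ _) = x <? y

All⇒<Head : ∀ {x ys} → All (x <_) ys → x <Head ys
All⇒<Head []       = tt
All⇒<Head (x<y ∷ _) = x<y

<Head⇒All : ∀ {x ys} → Ascending ys → x <Head ys → All (x <_) ys
<Head⇒All []          _   = []
<Head⇒All (y< ∷ _) x<y = x<y ∷ All.map (<-trans x<y) y<

module Exchange (k : ℕ) where

  m M : ℕ
  m = suc k
  M = 2 * m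

  PositiveMultiple : ℕ → Set
  PositiveMultiple e = M ∣ e × 0 < e

  M≤positiveMultiple : ∀ {e} → PositiveMultiple e → M ≤ e
  M≤positiveMultiple {suc _} (M∣e , _) = ∣⇒≤ M∣e

  multiples-spaced : ∀ {e e′} → M ∣ e → M ∣ e′ → e < e′ → e + M ≤ e′
  multiples-spaced (divides p refl) (divides q refl) p*M<q*M =
    subst (_≤ q * M) (+-comm M (p * M)) (*-monoˡ-≤ M (*-cancelʳ-< M p q p*M<q*M))

  odd+multiple : ∀ {o e} → M ∣ e → Odd o → Odd (o + e)
  odd+multiple {o} {e} M∣e odd 2∣o+e =
    odd (∣m+n∣m⇒∣n (subst (2 ∣_) (+-comm o e) 2∣o+e) (∣-trans (m∣m*n m) M∣e))

  odd+multiple⁻ : ∀ {o e} → M ∣ e → Odd (o + e) → Odd o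
  odd+multiple⁻ M∣e odd 2∣o = odd (∣m∣n⇒∣m+n 2∣o (∣-trans (m∣m*n m) M∣e))

  -- The largest multiple of M strictly below the gap g.
  cutGap : ℕ → ℕ
  cutGap g = (g ∸ 1) / M * M

  cutGap-decomposition : ∀ g → 1 ≤ g → g ≡ suc ((g ∸ 1) % M) + cutGap g
  cutGap-decomposition (suc g) _ = cong suc (m≡m%n+[m/n]*n g M)

  cutGap-absorbs : ∀ {ρ c} → ρ < M → M ∣ c → cutGap (suc ρ + c) ≡ c
  cutGap-absorbs {ρ} {c} ρ<M M∣c = begin
      (ρ + c) / M * M      ≡⟨ cong (_* M) (+-distrib-/-∣ʳ ρ M∣c) ⟩
      (ρ / M + c / M) * M  ≡⟨ cong (λ q → (q + c / M) * M) (m<n⇒m/n≡0 ρ<M) ⟩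
      c / M * M            ≡⟨ m/n*n≡m M∣c ⟩
      c ∎
    where open ≡-Reasoning

  cut : ℕ → ℕ → ℕ
  cut b o = cutGap (o ∸ b)

  cut-split : ∀ {b o} → b < o → M < o ∸ b →
              let o′ = o ∸ cut b o in
              b < o′ × o′ ∸ b ≤ M × PositiveMultiple (cut b o) × o′ + cut b o ≡ o
  cut-split {b} {o} b<o M<gap = b<o′ , gap′≤M , (n∣m*n ((gap ∸ 1) / M) , 0<c) , m∸n+n≡m c≤o
    where
    gap ρ c : ℕ
    gap = o ∸ b
    ρ = (gap ∸ 1) % M
    c = cut b o
    gap≡ : gap ≡ suc ρ + c
    gap≡ = cutGap-decomposition gap (m<n⇒0<n∸m b<o)
    o≡ : o ≡ b + suc ρ + c
    o≡ = trans (sym (m+[n∸m]≡n (<⇒≤ b<o))) (trans (cong (b +_) gap≡) (sym (ℕ.+-assoc b (suc ρ) c)))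
    o′≡ : o ∸ c ≡ b + suc ρ
    o′≡ = trans (cong (_∸ c) o≡) (m+n∸n≡m (b + suc ρ) c)
    b<o′ : b < o ∸ c
    b<o′ = subst (b <_) (sym o′≡) (m<m+n b z<s)
    gap′≤M : o ∸ c ∸ b ≤ M
    gap′≤M = subst (λ x → x ∸ b ≤ M) (sym o′≡)
               (subst (_≤ M) (sym (m+n∸m≡n b (suc ρ))) (m%n<n (gap ∸ 1) M))
    0<c : 0 < c
    0<c = n≢0⇒n>0 λ c≡0 → <⇒≱ M<gap (begin
      gap       ≡⟨ gap≡ ⟩
      suc ρ + c ≡⟨ cong (suc ρ +_) c≡0 ⟩
      suc ρ + 0 ≡⟨ ℕ.+-identityʳ (suc ρ) ⟩
      suc ρ     ≤⟨ m%n<n (gap ∸ 1) M ⟩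
      M         ∎)
      where open ≤-Reasoning
    c≤o : c ≤ o
    c≤o = subst (c ≤_) (sym o≡) (m≤n+m c (b + suc ρ))

  cut-absorbed : ∀ {b o c} → b < o → o ∸ b ≤ M → M ∣ c → cut b (o + c) ≡ c
  cut-absorbed {b} {o} {c} b<o gap≤M M∣c =
    trans (cong cutGap (+-∸-comm c (<⇒≤ b<o))) (absorbs (m<n⇒0<n∸m b<o) gap≤M)
    where
    absorbs : ∀ {d} → 1 ≤ d → d ≤ M → cutGap (d + c) ≡ c
    absorbs {suc ρ} _ ρ<M = cutGap-absorbs ρ<M M∣c

  Absorbs : ℕ → List ℕ → List ℕ → Set
  Absorbs o O []      = ⊥
  Absorbs o O (e ∷ _) = o + e <Head O

  -- Scan the odd parts upwards from b and act at the first part o that either has gap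
  -- o ∸ b larger than M, or can absorb the smallest even part e (gap at most M and o + e
  -- below the next odd part): split off the largest multiple of M below the gap as a new
  -- smallest even part, resp. absorb e.  The two moves undo each other.
  mutual
    exchange : ℕ → List ℕ → List ℕ → List ℕ × List ℕ
    exchange b []      E = [] , E
    exchange b (o ∷ O) E with M <? o ∸ b
    ... | yes _ = o ∸ cut b o ∷ O , cut b o ∷ E
    ... | no _  = absorbOrPass o O E

    absorbOrPass : ℕ → List ℕ → List ℕ → List ℕ × List ℕ
    absorbOrPass o O []      = map₁ (o ∷_) (exchange o O [])
    absorbOrPass o O (e ∷ E) with o + e <Head? O
    ... | yes _ = o + e ∷ O , E
    ... | no _  = map₁ (o ∷_) (exchange o O (e ∷ E))

  data Exchange (b : ℕ) : List ℕ → List ℕ → List ℕ → List ℕ → Set where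
    done   : ∀ {E} → Exchange b [] E [] E
    split  : ∀ {o O E} → M < o ∸ b → Exchange b (o ∷ O) E (o ∸ cut b o ∷ O) (cut b o ∷ E)
    absorb : ∀ {o O e E} → ¬ M < o ∸ b → o + e <Head O → Exchange b (o ∷ O) (e ∷ E) (o + e ∷ O) E
    pass   : ∀ {o O E O′ E′} → ¬ M < o ∸ b → ¬ Absorbs o O E → Exchange o O E O′ E′ →
             Exchange b (o ∷ O) E (o ∷ O′) E′

  mutual
    exchange-graph : ∀ b O E → Exchange b O E (proj₁ (exchange b O E)) (proj₂ (exchange b O E))
    exchange-graph b []      E = done
    exchange-graph b (o ∷ O) E with M <? o ∸ b
    ... | yes gap>M = split gap>M
    ... | no gap≤M  = absorbOrPass-graph gap≤M O E

    absorbOrPass-graph : ∀ {b o} → ¬ M < o ∸ b → ∀ O E →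
                         Exchange b (o ∷ O) E (proj₁ (absorbOrPass o O E)) (proj₂ (absorbOrPass o O E))
    absorbOrPass-graph gap≤M O [] = pass gap≤M (λ ()) (exchange-graph _ O [])
    absorbOrPass-graph {o = o} gap≤M O (e ∷ E) with o + e <Head? O
    ... | yes fits = absorb gap≤M fits
    ... | no ¬fits = pass gap≤M ¬fits (exchange-graph _ O (e ∷ E))

  Exchange-functional : ∀ {b O E O₁ E₁ O₂ E₂} → Exchange b O E O₁ E₁ → Exchange b O E O₂ E₂ →
                        (O₁ , E₁) ≡ (O₂ , E₂)
  Exchange-functional done           done           = refl
  Exchange-functional (split _)      (split _)      = refl
  Exchange-functional (split g)      (absorb ¬g _)  = ⊥-elim (¬g g)
  Exchange-functional (split g)      (pass ¬g _ _)  = ⊥-elim (¬g g)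
  Exchange-functional (absorb ¬g _)  (split g)      = ⊥-elim (¬g g)
  Exchange-functional (absorb _ _)   (absorb _ _)   = refl
  Exchange-functional (absorb _ f)   (pass _ ¬f _)  = ⊥-elim (¬f f)
  Exchange-functional (pass ¬g _ _)  (split g)      = ⊥-elim (¬g g)
  Exchange-functional (pass _ ¬f _)  (absorb _ f)   = ⊥-elim (¬f f)
  Exchange-functional (pass _ _ d₁)  (pass _ _ d₂)  = cong (map₁ (_ ∷_)) (Exchange-functional d₁ d₂)

  FirstGap≤Even : ℕ → List ℕ → List ℕ → Set
  FirstGap≤Even b (o ∷ _) (e ∷ _) = o ≤ e + b
  FirstGap≤Even b _       _       = ⊤

  -- The state of the scan: b is the last odd part passed, O the odd parts still to come,
  -- E the even parts available for absorption.
  record Admissible (b : ℕ) (O E : List ℕ) : Set where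
    constructor admissible
    field
      ascending     : Ascending O
      above         : All (b <_) O
      odd           : All Odd O
      evenAscending : Ascending E
      evenPositive  : All PositiveMultiple E
      firstGap      : FirstGap≤Even b O E

  module _ {b o c} (b<o : b < o) (gap≤M : o ∸ b ≤ M) (c⁺ : PositiveMultiple c) where

    absorb-admissible : ∀ {O E} → o + c <Head O → Admissible b (o ∷ O) (c ∷ E) →
                        Admissible b (o + c ∷ O) E
    absorb-admissible {O} {E} fits (admissible (_ ∷ aO) (_ ∷ above) (odd ∷ odds) (c< ∷ aE) (_ ∷ E⁺) _) =
      admissible (<Head⇒All aO fits ∷ aO) (<-≤-trans b<o (m≤m+n o c) ∷ above)
        (odd+multiple (proj₁ c⁺) odd ∷ odds) aE E⁺ (firstGap E c< E⁺)
      where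
      firstGap : ∀ E → All (c <_) E → All PositiveMultiple E → FirstGap≤Even b (o + c ∷ O) E
      firstGap []      _          _              = tt
      firstGap (e ∷ _) (c<e ∷ _) ((M∣e , _) ∷ _) = begin
        o + c        ≤⟨ +-monoˡ-≤ c (m∸n≤o⇒m≤o+n (<⇒≤ b<o) gap≤M) ⟩
        M + b + c    ≡⟨ m+n+o≡o+m+n M b c ⟩
        c + M + b    ≤⟨ +-monoˡ-≤ b (multiples-spaced (proj₁ c⁺) M∣e c<e) ⟩
        e + b        ∎
        where open ≤-Reasoning

    split-admissible : ∀ {O E} → Admissible b (o + c ∷ O) E → Admissible b (o ∷ O) (c ∷ E)
    split-admissible {O} {E} (admissible (o+c< ∷ aO) (_ ∷ above) (odd ∷ odds) aE E⁺ first) =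
      admissible (All.map (<-trans o<o+c) o+c< ∷ aO) (b<o ∷ above)
        (odd+multiple⁻ (proj₁ c⁺) odd ∷ odds) (c<E E aE first ∷ aE) (c⁺ ∷ E⁺)
        (≤-trans (m∸n≤o⇒m≤o+n (<⇒≤ b<o) gap≤M) (+-monoˡ-≤ b (M≤positiveMultiple c⁺)))
      where
      o<o+c : o < o + c
      o<o+c = m<m+n o (proj₂ c⁺)
      c<E : ∀ E → Ascending E → FirstGap≤Even b (o + c ∷ O) E → All (c <_) E
      c<E []      _         _          = []
      c<E (e ∷ _) (e< ∷ _) o+c≤e+b = c<e ∷ All.map (<-trans c<e) e<
        where
        c<e : c < e
        c<e = +-cancelˡ-< b c e (<-≤-trans (+-monoˡ-< c b<o) (subst (o + c ≤_) (+-comm e b) o+c≤e+b))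

    split-off : ∀ {O E} → Exchange b (o + c ∷ O) E (o ∷ O) (c ∷ E)
    split-off {O} {E} = subst₂ (λ o′ c′ → Exchange b (o + c ∷ O) E (o′ ∷ O) (c′ ∷ E))
      (trans (cong (o + c ∸_) cut≡c) (m+n∸n≡m o c)) cut≡c (split M<gap)
      where
      cut≡c : cut b (o + c) ≡ c
      cut≡c = cut-absorbed b<o gap≤M (proj₁ c⁺)
      M<gap : M < o + c ∸ b
      M<gap = subst (M <_) (sym (+-∸-comm c (<⇒≤ b<o)))
                (+-mono-≤ (m<n⇒0<n∸m b<o) (M≤positiveMultiple c⁺))

  admissible-tail : ∀ {b o O E} → ¬ Absorbs o O E → Admissible b (o ∷ O) E → Admissible o O E
  admissible-tail {O = O} {E} ¬a (admissible (o< ∷ aO) _ (_ ∷ odds) aE E⁺ _) =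
    admissible aO o< odds aE E⁺ (firstGap O E ¬a)
    where
    firstGap : ∀ {o} O E → ¬ Absorbs o O E → FirstGap≤Even o O E
    firstGap []      _       _  = tt
    firstGap (_ ∷ _) []      _  = tt
    firstGap {o} (o₁ ∷ _) (e ∷ _) ¬a = subst (o₁ ≤_) (+-comm o e) (≮⇒≥ ¬a)

  admissible-∷ : ∀ {b o O E} → b < o → o ∸ b ≤ M → Odd o → Admissible o O E →
                 Admissible b (o ∷ O) E
  admissible-∷ {b} {o} {O} {E} b<o gap≤M odd (admissible aO o< odds aE E⁺ _) =
    admissible (o< ∷ aO) (b<o ∷ All.map (<-trans b<o) o<) (odd ∷ odds) aE E⁺ (firstGap E E⁺)
    where
    firstGap : ∀ E → All PositiveMultiple E → FirstGap≤Even b (o ∷ O) E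
    firstGap []      _          = tt
    firstGap (_ ∷ _) (e⁺ ∷ _) =
      ≤-trans (m∸n≤o⇒m≤o+n (<⇒≤ b<o) gap≤M) (+-monoˡ-≤ b (M≤positiveMultiple e⁺))

  ¬Absorbs-back : ∀ {o O E O′ E′} → ¬ Absorbs o O E → Admissible o O′ E′ → Exchange o O′ E′ O E →
                  ¬ Absorbs o O′ E′
  ¬Absorbs-back {E′ = []} _ _ _ ()
  ¬Absorbs-back {O′ = []} {_ ∷ _} ¬a _ done = ¬a
  ¬Absorbs-back {o} {O′ = o₁ ∷ _} {e ∷ _} _ adm _ fits =
    <⇒≱ fits (subst (o₁ ≤_) (+-comm e o) (Admissible.firstGap adm))

  exchange-involutive : ∀ {b O E O′ E′} → Admissible b O E → Exchange b O E O′ E′ →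
                        Admissible b O′ E′ × Exchange b O′ E′ O E
  exchange-involutive adm done = adm , done
  exchange-involutive {b} {o ∷ O} {E} adm (split M<gap)
    with cut-split (All.head (Admissible.above adm)) M<gap
  ... | b<o′ , gap′≤M , c⁺ , o′+c≡o =
    split-admissible b<o′ gap′≤M c⁺ (subst (λ x → Admissible b (x ∷ O) E) (sym o′+c≡o) adm) ,
    subst (λ x → Exchange b (o ∸ cut b o ∷ O) (cut b o ∷ E) (x ∷ O) E) o′+c≡o (absorb (≤⇒≯ gap′≤M) fits)
    where
    fits : o ∸ cut b o + cut b o <Head O
    fits = All⇒<Head (subst (λ x → All (x <_) O) (sym o′+c≡o) (AllPairs.head (Admissible.ascending adm)))
  exchange-involutive {b} {o ∷ _} adm@(admissible _ (b<o ∷ _) _ _ (e⁺ ∷ _) _) (absorb ¬M<gap fits) =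
    absorb-admissible b<o gap≤M e⁺ fits adm , split-off b<o gap≤M e⁺
    where
    gap≤M : o ∸ b ≤ M
    gap≤M = ≮⇒≥ ¬M<gap
  exchange-involutive adm@(admissible _ (b<o ∷ _) (odd ∷ _) _ _ _) (pass ¬M<gap ¬a d)
    with exchange-involutive (admissible-tail ¬a adm) d
  ... | adm′ , d′ = admissible-∷ b<o (≮⇒≥ ¬M<gap) odd adm′ , pass ¬M<gap (¬Absorbs-back ¬a adm′ d′) d′

  Gaps : ℕ → List ℕ → Set
  Gaps b O = Linked (λ x y → y ∸ x ≤ M) (b ∷ O)

  Stuck : ℕ → List ℕ → List ℕ → Set
  Stuck b O E = O ≡ [] ⊎ (E ≡ [] × Gaps b O)

  exchange-moves : ∀ {b O E O′ E′} → Exchange b O E O′ E′ →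
                   Adjacent (length E) (length E′) ⊎ (O′ ≡ O × E′ ≡ E × Stuck b O E)
  exchange-moves done         = inj₂ (refl , refl , inj₁ refl)
  exchange-moves (split _)    = inj₁ (inj₁ refl)
  exchange-moves (absorb _ _) = inj₁ (inj₂ refl)
  exchange-moves {E = E} (pass ¬M<gap ¬a d) with exchange-moves d
  ... | inj₁ adj = inj₁ adj
  ... | inj₂ (refl , refl , stuck) = inj₂ (refl , refl , inj₂ (stuck′ E ¬a stuck))
    where
    stuck′ : ∀ E → ¬ Absorbs _ _ E → Stuck _ _ E → E ≡ [] × Gaps _ (_ ∷ _)
    stuck′ []      _  (inj₁ refl)         = refl , ≮⇒≥ ¬M<gap ∷ [-]
    stuck′ (_ ∷ _) ¬a (inj₁ refl)         = ⊥-elim (¬a tt)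
    stuck′ _       _  (inj₂ (refl , gaps)) = refl , ≮⇒≥ ¬M<gap ∷ gaps

  gaps-fixed : ∀ {b O} → Gaps b O → Exchange b O [] O []
  gaps-fixed {O = []}    _            = done
  gaps-fixed {O = _ ∷ _} (gap ∷ gaps) = pass (≤⇒≯ gap) (λ ()) (gaps-fixed gaps)

  exchange-length : ∀ {b O E O′ E′} → Exchange b O E O′ E′ → length O′ ≡ length O
  exchange-length done         = refl
  exchange-length (split _)    = refl
  exchange-length (absorb _ _) = refl
  exchange-length (pass _ _ d) = cong suc (exchange-length d)

  exchange-sum : ∀ {b O E O′ E′} → Exchange b O E O′ E′ → sum O′ + sum E′ ≡ sum O + sum E
  exchange-sum done = refl
  exchange-sum {b} {o ∷ O} {E} (split _) =
    trans (m+o+[n+p]≡m+n+o+p (o ∸ cut b o) (cut b o) (sum O) (sum E))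
          (cong (λ x → x + sum O + sum E) (m∸n+n≡m cut≤o))
    where
    cut≤o : cut b o ≤ o
    cut≤o = ≤-trans (m/n*n≤m _ M) (≤-trans (m∸n≤m _ 1) (m∸n≤m o b))
  exchange-sum {O = o ∷ O} {e ∷ E} (absorb _ _) = sym (m+o+[n+p]≡m+n+o+p o e (sum O) (sum E))
  exchange-sum {O = o ∷ O} {E} {_ ∷ O′} {E′} (pass _ _ d) = begin
    o + sum O′ + sum E′    ≡⟨ ℕ.+-assoc o (sum O′) (sum E′) ⟩
    o + (sum O′ + sum E′)  ≡⟨ cong (o +_) (exchange-sum d) ⟩
    o + (sum O + sum E)    ≡⟨ ℕ.+-assoc o (sum O) (sum E) ⟨
    o + sum O + sum E      ∎
    where open ≡-Reasoning

module Toggle (k : ℕ) where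
  open Exchange k

  Removable : List ℕ → List ℕ → Set
  Removable O []      = ⊥
  Removable O (e ∷ _) = e <Head O

  removable? : ∀ O E → Dec (Removable O E)
  removable? O []      = no λ ()
  removable? O (e ∷ _) = e <Head? O

  -- Insert or remove the part 0 when the smallest positive even part lies below all odd
  -- parts; otherwise keep 0 and rearrange the other parts by the exchange scan from 0.
  -- (E = [] never occurs: the smallest part of a partition in A_m is even.)
  toggle : List ℕ → List ℕ → List ℕ × List ℕ
  toggle O []          = O , []
  toggle O (suc e ∷ E) = O , 0 ∷ suc e ∷ E
  toggle O (zero ∷ E) with removable? O E
  ... | yes _ = O , E
  ... | no _  = map₂ (0 ∷_) (exchange 0 O E)

  data Toggle : List ℕ → List ℕ → List ℕ → List ℕ → Set where
    insert0   : ∀ {O e E} → Toggle O (suc e ∷ E) O (0 ∷ suc e ∷ E)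
    remove0   : ∀ {O E} → Removable O E → Toggle O (0 ∷ E) O E
    exchange0 : ∀ {O E O′ E′} → ¬ Removable O E → Exchange 0 O E O′ E′ → Toggle O (0 ∷ E) O′ (0 ∷ E′)

  SmallestEven : List ℕ → List ℕ → Set
  SmallestEven O []      = ⊥
  SmallestEven O (e ∷ _) = All (e <_) O

  -- The odd parts O and the even parts E of a partition in A_m, both in increasing order.
  record Valid (O E : List ℕ) : Set where
    constructor valid
    field
      ascending     : Ascending O
      odd           : All Odd O
      evenAscending : Ascending E
      multiple      : All (M ∣_) E
      smallestEven  : SmallestEven O E

  toggle-graph : ∀ {O E} → Valid O E → Toggle O E (proj₁ (toggle O E)) (proj₂ (toggle O E))
  toggle-graph {O} {suc e ∷ E} _ = insert0
  toggle-graph {O} {zero ∷ E}  _ with removable? O E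
  ... | yes r = remove0 r
  ... | no ¬r = exchange0 ¬r (exchange-graph 0 O E)

  Toggle-functional : ∀ {O E O₁ E₁ O₂ E₂} → Toggle O E O₁ E₁ → Toggle O E O₂ E₂ →
                      (O₁ , E₁) ≡ (O₂ , E₂)
  Toggle-functional insert0          insert0          = refl
  Toggle-functional (remove0 _)      (remove0 _)      = refl
  Toggle-functional (remove0 r)      (exchange0 ¬r _) = ⊥-elim (¬r r)
  Toggle-functional (exchange0 ¬r _) (remove0 r)      = ⊥-elim (¬r r)
  Toggle-functional (exchange0 _ d₁) (exchange0 _ d₂) = cong (map₂ (0 ∷_)) (Exchange-functional d₁ d₂)

  Toggle⇒toggle : ∀ {O E O′ E′} → Valid O E → Toggle O E O′ E′ → toggle O E ≡ (O′ , E′)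
  Toggle⇒toggle v = Toggle-functional (toggle-graph v)

  Valid⇒Admissible : ∀ {O E} → ¬ Removable O E → Valid O (0 ∷ E) → Admissible 0 O E
  Valid⇒Admissible {O} {E} ¬r (valid aO odd (0< ∷ aE) (_ ∷ M∣E) _) =
    admissible aO (All.map odd⇒positive odd) odd aE (All.zip (M∣E , 0<)) (firstGap O E ¬r)
    where
    firstGap : ∀ O E → ¬ Removable O E → FirstGap≤Even 0 O E
    firstGap []      _       _  = tt
    firstGap (_ ∷ _) []      _  = tt
    firstGap (o ∷ _) (e ∷ _) ¬r = subst (o ≤_) (sym (ℕ.+-identityʳ e)) (≮⇒≥ ¬r)

  Admissible⇒Valid : ∀ {O E} → Admissible 0 O E → Valid O (0 ∷ E)
  Admissible⇒Valid (admissible aO 0<O odd aE E⁺ _) =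
    valid aO odd (All.map proj₂ E⁺ ∷ aE) ((M ∣0) ∷ All.map proj₁ E⁺) 0<O

  ¬Removable-back : ∀ {O E O′ E′} → ¬ Removable O E → Admissible 0 O′ E′ → Exchange 0 O′ E′ O E →
                    ¬ Removable O′ E′
  ¬Removable-back {E′ = []} _ _ _ ()
  ¬Removable-back {O′ = []} {_ ∷ _} ¬r _ done = ¬r
  ¬Removable-back {O′ = o ∷ _} {e ∷ _} _ adm _ e<o =
    <⇒≱ e<o (subst (o ≤_) (ℕ.+-identityʳ e) (Admissible.firstGap adm))

  toggle-involutive : ∀ {O E O′ E′} → Valid O E → Toggle O E O′ E′ → Valid O′ E′ × Toggle O′ E′ O E
  toggle-involutive (valid aO odd (e< ∷ aE) (M∣e ∷ M∣E) e<O) insert0 =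
    valid aO odd ((z<s ∷ All.map (<-trans z<s) e<) ∷ e< ∷ aE) ((M ∣0) ∷ M∣e ∷ M∣E) (All.map odd⇒positive odd) ,
    remove0 (All⇒<Head e<O)
  toggle-involutive {E = 0 ∷ zero ∷ _}  (valid _ _ ((() ∷ _) ∷ _) _ _) (remove0 _)
  toggle-involutive {E = 0 ∷ suc _ ∷ _} (valid aO odd (_ ∷ aE) (_ ∷ M∣E) _) (remove0 e<O) =
    valid aO odd aE M∣E (<Head⇒All aO e<O) , insert0
  toggle-involutive v (exchange0 ¬r d) with exchange-involutive (Valid⇒Admissible ¬r v) d
  ... | adm′ , d′ = Admissible⇒Valid adm′ , exchange0 (¬Removable-back ¬r adm′ d′) d′

  toggle-moves : ∀ {O E O′ E′} → Toggle O E O′ E′ →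
                 Adjacent (length E) (length E′) ⊎ (O′ ≡ O × E′ ≡ E × E ≡ 0 ∷ [] × Gaps 0 O)
  toggle-moves insert0     = inj₁ (inj₁ refl)
  toggle-moves (remove0 _) = inj₁ (inj₂ refl)
  toggle-moves {E = 0 ∷ E} (exchange0 ¬r d) with exchange-moves d
  ... | inj₁ (inj₁ eq) = inj₁ (inj₁ (cong suc eq))
  ... | inj₁ (inj₂ eq) = inj₁ (inj₂ (cong suc eq))
  ... | inj₂ (refl , refl , stuck) = inj₂ (refl , refl , stuck′ E ¬r stuck)
    where
    stuck′ : ∀ {O} E → ¬ Removable O E → Stuck 0 O E → 0 ∷ E ≡ 0 ∷ [] × Gaps 0 O
    stuck′ []      _  (inj₁ refl)         = refl , [-]
    stuck′ (_ ∷ _) ¬r (inj₁ refl)         = ⊥-elim (¬r tt)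
    stuck′ _       _  (inj₂ (refl , gaps)) = refl , gaps

  gaps-toggle-fixed : ∀ {O} → Gaps 0 O → Toggle O (0 ∷ []) O (0 ∷ [])
  gaps-toggle-fixed gaps = exchange0 (λ ()) (gaps-fixed gaps)

  toggle-length : ∀ {O E O′ E′} → Toggle O E O′ E′ → length O′ ≡ length O
  toggle-length insert0         = refl
  toggle-length (remove0 _)     = refl
  toggle-length (exchange0 _ d) = exchange-length d

  toggle-sum : ∀ {O E O′ E′} → Toggle O E O′ E′ → sum O′ + sum E′ ≡ sum O + sum E
  toggle-sum insert0                  = refl
  toggle-sum {E = 0 ∷ _} (remove0 _)  = refl
  toggle-sum (exchange0 _ d)          = exchange-sum d

_≟L_ : (xs ys : List ℕ) → Dec (xs ≡ ys)
_≟L_ = ≡-dec _≟_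

module Involution (k : ℕ) where
  open Exchange k
  open Toggle k

  encode : List ℕ → List ℕ × List ℕ
  encode λs = odds (reverse λs) , evens (reverse λs)

  decode : List ℕ × List ℕ → List ℕ
  decode (O , E) = reverse (combine O E)

  φ : List ℕ → List ℕ
  φ λs = decode (uncurry toggle (encode λs))

  decode-↭ : ∀ O E → decode (O , E) ↭ O ++ E
  decode-↭ O E = ↭-trans (↭-reverse (combine O E)) (merge-↭ _ O E)

  sum-decode : ∀ O E → sum (decode (O , E)) ≡ sum O + sum E
  sum-decode O E = trans (sum-↭ (decode-↭ O E)) (sum-++ O E)

  length-decode : ∀ O E → length (decode (O , E)) ≡ length O + length E
  length-decode O E = trans (length-reverse (combine O E)) (length-combine O E)

  ℓₒ-decode : ∀ {O E} → Valid O E → ℓₒ (decode (O , E)) ≡ length O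
  ℓₒ-decode {O} {E} v =
    ↭-length (odds-↭ (Valid.odd v) (All.map (∣-trans (m∣m*n m)) (Valid.multiple v)) (decode-↭ O E))

  sum-encode : ∀ λs → sum (odds (reverse λs)) + sum (evens (reverse λs)) ≡ sum λs
  sum-encode λs = begin
    sum (odds r) + sum (evens r) ≡⟨ sum-++ (odds r) (evens r) ⟨
    sum (odds r ++ evens r)      ≡⟨ sum-↭ (↭-trans (odds++evens-↭ r) (↭-reverse λs)) ⟩
    sum λs                       ∎
    where
    open ≡-Reasoning
    r : List ℕ
    r = reverse λs

  decode-encode : ∀ {λs} → StrictDec λs → decode (encode λs) ≡ λs
  decode-encode {λs} sd =
    trans (cong reverse (combine-odds-evens (StrictDec⇒Ascending-reverse sd))) (reverse-involutive λs)

  encode-decode : ∀ {O E} → Valid O E → encode (decode (O , E)) ≡ (O , E)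
  encode-decode {O} {E} (valid aO odd aE M∣E _) rewrite reverse-involutive (combine O E) =
    cong₂ _,_ (odds-combine odd even aO aE) (evens-combine odd even aO aE)
    where
    even : All Even E
    even = All.map (∣-trans (m∣m*n m)) M∣E

  φ-decode : ∀ {O E} → Valid O E → φ (decode (O , E)) ≡ decode (toggle O E)
  φ-decode v = cong (decode ∘ uncurry toggle) (encode-decode v)

  decode-smallest : ∀ {O e} E → All (e <_) O → decode (O , e ∷ E) ≡ decode (O , E) ∷ʳ e
  decode-smallest {O} {e} E e<O = trans (cong reverse (combine-∷ʳ E e<O)) (unfold-reverse e (combine O E))

  InA⇒Valid : ∀ {n λs} → InA m n λs → Valid (odds (reverse λs)) (evens (reverse λs))
  InA⇒Valid {n} {λs} a =
    valid (AllPairs.filter⁺ _ ar) (All.all-filter odd? (reverse λs)) (AllPairs.filter⁺ _ ar)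
      (All.zipWith (λ (even⇒M∣ , even) → even⇒M∣ even)
        (All.filter⁺ even? (All-reverse⁺ (InA.evenMult a)) , All.all-filter even? (reverse λs)))
      smallest-below
    where
    open InA a using (init; smallest; smallestEven) renaming (split to λs≡)
    ar : Ascending (reverse λs)
    ar = StrictDec⇒Ascending-reverse (InA.strict a)
    r≡ : reverse λs ≡ smallest ∷ reverse init
    r≡ = trans (cong reverse λs≡) (reverse-∷ʳ init smallest)
    smallest-below : SmallestEven (odds (reverse λs)) (evens (reverse λs))
    smallest-below rewrite r≡ | filter-reject odd? {xs = reverse init} (λ odd → odd smallestEven)
                        | filter-accept even? {xs = reverse init} smallestEven =
      All.filter⁺ _ (AllPairs.head (subst Ascending r≡ ar))

  Valid⇒InA : ∀ {n O E} → Valid O E → sum O + sum E ≡ n → InA m n (decode (O , E))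
  Valid⇒InA {n} {O} {e ∷ E} v@(valid aO odd aE M∣E e<O) sum≡n = record
    { strict       = Ascending⇒StrictDec-reverse (combine-ascending odd even aO aE)
    ; sumIs        = trans (sum-decode O (e ∷ E)) sum≡n
    ; evenMult     = All-resp-↭ (↭-sym (decode-↭ O (e ∷ E)))
                       (All.++⁺ (All.map (λ odd even → ⊥-elim (odd even)) odd) (All.map (λ M∣x _ → M∣x) M∣E))
    ; init         = decode (O , E)
    ; smallest     = e
    ; split        = decode-smallest E e<O
    ; smallestEven = All.head even
    }
    where
    even : All Even (e ∷ E)
    even = All.map (∣-trans (m∣m*n m)) M∣E

  decode-0 : ∀ {O} → All (0 <_) O → decode (O , 0 ∷ []) ≡ reverse O ∷ʳ 0
  decode-0 {O} 0<O = trans (decode-smallest [] 0<O) (cong (λ xs → reverse xs ∷ʳ 0) (combine-[]ʳ O))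

  module _ {n λs} (a : InA m n λs) where
    private
      O E O′ E′ : List ℕ
      O = odds (reverse λs)
      E = evens (reverse λs)
      O′ = proj₁ (toggle O E)
      E′ = proj₂ (toggle O E)
      v : Valid O E
      v = InA⇒Valid a
      t : Toggle O E O′ E′
      t = toggle-graph v
      v′ : Valid O′ E′
      v′ = proj₁ (toggle-involutive v t)
      λs≡ : decode (O , E) ≡ λs
      λs≡ = decode-encode (InA.strict a)

    φ-InA : InA m n (φ λs)
    φ-InA = Valid⇒InA v′ (trans (toggle-sum t) (trans (sum-encode λs) (InA.sumIs a)))

    φ-involutive : φ (φ λs) ≡ λs
    φ-involutive = begin
      φ (decode (O′ , E′))   ≡⟨ φ-decode v′ ⟩
      decode (toggle O′ E′)  ≡⟨ cong decode (Toggle⇒toggle v′ (proj₂ (toggle-involutive v t))) ⟩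
      decode (O , E)         ≡⟨ λs≡ ⟩
      λs                     ∎
      where open ≡-Reasoning

    φ-fixed⇒B : φ λs ≡ λs → Σ[ μ ∈ List ℕ ] InB m n μ × λs ≡ μ ∷ʳ 0
    φ-fixed⇒B fixed with toggle-moves t
    ... | inj₁ adj = ⊥-elim (Adjacent-irrefl (subst (Adjacent _) (cong (length ∘ proj₂) toggle≡) adj))
      where
      toggle≡ : (O′ , E′) ≡ (O , E)
      toggle≡ = trans (sym (encode-decode v′)) (cong encode fixed)
    ... | inj₂ (_ , _ , E≡0 , gaps) =
      reverse O , inB , trans (sym λs≡) (trans (cong (decode ∘ (O ,_)) E≡0) (decode-0 0<O))
      where
      open Valid v
      0<O : All (0 <_) O
      0<O = All.map odd⇒positive odd
      inB : InB m n (reverse O)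
      inB = record
        { strict = Ascending⇒StrictDec-reverse ascending
        ; odd    = All-reverse⁺ odd
        ; sumIs  = trans (sum-↭ (↭-reverse O)) (begin
            sum O                ≡⟨ ℕ.+-identityʳ (sum O) ⟨
            sum O + sum (0 ∷ []) ≡⟨ cong (λ xs → sum O + sum xs) E≡0 ⟨
            sum O + sum E        ≡⟨ sum-encode λs ⟩
            sum λs               ≡⟨ InA.sumIs a ⟩
            n                    ∎)
        ; gaps   = subst (Linked _) (unfold-reverse 0 O) (Linked-reverse⁺ gaps)
        }
        where open ≡-Reasoning

    φ-moved : φ λs ≢ λs → ℓₒ (φ λs) ≡ ℓₒ λs × Adjacent (length λs) (length (φ λs))
    φ-moved moved with toggle-moves t
    ... | inj₂ (O′≡O , E′≡E , _) = ⊥-elim (moved (trans (cong decode (cong₂ _,_ O′≡O E′≡E)) λs≡))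
    ... | inj₁ adj = ℓₒ≡ , subst₂ Adjacent length-λs length-φλs (Adjacent-+ (length O) adj)
      where
      length-λs : length O + length E ≡ length λs
      length-λs = trans (sym (length-decode O E)) (cong length λs≡)
      length-φλs : length O + length E′ ≡ length (φ λs)
      length-φλs = trans (cong (_+ length E′) (sym (toggle-length t))) (sym (length-decode O′ E′))
      ℓₒ≡ : ℓₒ (φ λs) ≡ ℓₒ λs
      ℓₒ≡ = begin
        ℓₒ (φ λs)          ≡⟨ ℓₒ-decode v′ ⟩
        length O′          ≡⟨ toggle-length t ⟩
        length O           ≡⟨ ℓₒ-decode v ⟨
        ℓₒ (decode (O , E)) ≡⟨ cong ℓₒ λs≡ ⟩
        ℓₒ λs              ∎
        where open ≡-Reasoning

  B⇒φ-fixed : ∀ {n μ} → InB m n μ → InA m n (μ ∷ʳ 0) × φ (μ ∷ʳ 0) ≡ μ ∷ʳ 0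
  B⇒φ-fixed {n} {μ} b = subst (InA m n) μ∷ʳ0≡ (Valid⇒InA v sum≡) , (begin
      φ (μ ∷ʳ 0)                  ≡⟨ cong φ μ∷ʳ0≡ ⟨
      φ (decode (O , 0 ∷ []))     ≡⟨ φ-decode v ⟩
      decode (toggle O (0 ∷ []))  ≡⟨ cong decode (Toggle⇒toggle v (gaps-toggle-fixed gaps)) ⟩
      decode (O , 0 ∷ [])         ≡⟨ μ∷ʳ0≡ ⟩
      μ ∷ʳ 0                      ∎)
    where
    open ≡-Reasoning
    O : List ℕ
    O = reverse μ
    odd : All Odd O
    odd = All-reverse⁺ (InB.odd b)
    0<O : All (0 <_) O
    0<O = All.map odd⇒positive odd
    v : Valid O (0 ∷ [])
    v = valid (StrictDec⇒Ascending-reverse (InB.strict b)) odd ([] ∷ []) ((M ∣0) ∷ []) 0<O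
    μ∷ʳ0≡ : decode (O , 0 ∷ []) ≡ μ ∷ʳ 0
    μ∷ʳ0≡ = trans (decode-0 0<O) (cong (_∷ʳ 0) (reverse-involutive μ))
    sum≡ : sum O + sum (0 ∷ []) ≡ n
    sum≡ = trans (ℕ.+-identityʳ (sum O)) (trans (sum-↭ (↭-reverse μ)) (InB.sumIs b))
    gaps : Gaps 0 O
    gaps = subst (Linked _) (reverse-∷ʳ μ 0) (Linked-reverse⁺ (InB.gaps b))

  fixedPoints-↭ : ∀ {n LA LB} → Enumerates (InA m n) LA → Enumerates (InB m n) LB →
                  filter (λ λs → φ λs ≟L λs) LA ↭ map (_∷ʳ 0) LB
  fixedPoints-↭ {n} {LA} {LB} (uA , memA) (uB , memB) =
    ∼bag⇒↭ (unique∧set⇒bag (Unique.filter⁺ _ uA) (Unique.map⁺ (∷ʳ-injectiveˡ _ _) uB)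
                            (mk⇔ fixed⇒B B⇒fixed))
    where
    fixed⇒B : ∀ {λs} → λs ∈ filter (λ λs → φ λs ≟L λs) LA → λs ∈ map (_∷ʳ 0) LB
    fixed⇒B λs∈ with ∈-filter⁻ _ {xs = LA} λs∈
    ... | λs∈LA , fixed with φ-fixed⇒B (Equivalence.to (memA _) λs∈LA) fixed
    ...   | μ , inB , refl = ∈-map⁺ (_∷ʳ 0) (Equivalence.from (memB μ) inB)
    B⇒fixed : ∀ {λs} → λs ∈ map (_∷ʳ 0) LB → λs ∈ filter (λ λs → φ λs ≟L λs) LA
    B⇒fixed λs∈ with ∈-map⁻ (_∷ʳ 0) λs∈
    ... | μ , μ∈LB , refl with B⇒φ-fixed (Equivalence.to (memB μ) μ∈LB)
    ...   | inA , fixed = ∈-filter⁺ _ (Equivalence.from (memA _) inA) fixed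

InA-nonempty : ∀ {m n λs} → InA m n λs → 1 ≤ length λs
InA-nonempty a rewrite InA.split a | length-++ (InA.init a) {InA.smallest a ∷ []} = m≤n+m 1 _

module Weights {c ℓ} (R : CommutativeRing c ℓ) (a : CommutativeRing.Carrier R) where
  open CommutativeRing R renaming (_+_ to _⊕_; _*_ to _·_; refl to ≈-refl; sym to ≈-sym; trans to ≈-trans)
  open import Algebra.Properties.Ring ring using (-1*x≈-x; -‿involutive)
  open import Algebra.Properties.CommutativeSemigroup *-commutativeSemigroup using (interchange)
  open import Relation.Binary.Reasoning.Setoid setoid

  pow-neg-one : ∀ l → pow R (- 1#) l · pow R a l ≈ pow R (- a) l
  pow-neg-one zero    = *-identityˡ 1#
  pow-neg-one (suc l) = begin
    (- 1# · pow R (- 1#) l) · (a · pow R a l) ≈⟨ interchange _ _ _ _ ⟩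
    (- 1# · a) · (pow R (- 1#) l · pow R a l) ≈⟨ *-cong (-1*x≈-x a) (pow-neg-one l) ⟩
    - a · pow R (- a) l                       ∎

  ω₁-∷ʳ0 : ∀ {μ} → All Odd μ → ω₁ R a (μ ∷ʳ 0) ≈ ω₂ R a μ
  ω₁-∷ʳ0 {μ} odd = begin
    pow R (- 1#) (length (μ ∷ʳ 0) ∸ 1) · pow R a (ℓₒ (μ ∷ʳ 0))
      ≈⟨ reflexive (cong₂ (λ l o → pow R (- 1#) l · pow R a o)
                          (≡.trans (cong (_∸ 1) (length-++ μ)) (m+n∸n≡m (length μ) 1)) ℓₒ≡) ⟩
    pow R (- 1#) (length μ) · pow R a (length μ) ≈⟨ pow-neg-one (length μ) ⟩
    pow R (- a) (length μ)                       ∎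
    where
    ℓₒ≡ : ℓₒ (μ ∷ʳ 0) ≡ length μ
    ℓₒ≡ = cong length (≡.trans (filter-++ odd? μ (0 ∷ []))
                         (≡.trans (++-identityʳ (odds μ)) (filter-all odd? odd)))

  sign-step : ∀ l x → 1 ≤ l → pow R (- 1#) l · x ≈ - (pow R (- 1#) (l ∸ 1) · x)
  sign-step (suc l) x _ = ≈-trans (*-assoc _ _ _) (-1*x≈-x _)

  ω₁-flip : ∀ u v → ℓₒ u ≡ ℓₒ v → length u ≡ suc (length v) → 1 ≤ length v →
            ω₁ R a u ≈ - ω₁ R a v
  ω₁-flip u v ℓₒ≡ len≡ 1≤len = begin
    pow R (- 1#) (length u ∸ 1) · pow R a (ℓₒ u)
      ≈⟨ reflexive (cong₂ (λ l o → pow R (- 1#) (l ∸ 1) · pow R a o) len≡ ℓₒ≡) ⟩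
    pow R (- 1#) (length v) · pow R a (ℓₒ v)     ≈⟨ sign-step (length v) _ 1≤len ⟩
    - ω₁ R a v                                   ∎

  ω₁-adjacent : ∀ u v → ℓₒ u ≡ ℓₒ v → Adjacent (length v) (length u) → 1 ≤ length u → 1 ≤ length v →
                ω₁ R a u ≈ - ω₁ R a v
  ω₁-adjacent u v ℓₒ≡ (inj₁ len≡) _ 1≤v = ω₁-flip u v ℓₒ≡ len≡ 1≤v
  ω₁-adjacent u v ℓₒ≡ (inj₂ len≡) 1≤u _ = begin
    ω₁ R a u       ≈⟨ -‿involutive (ω₁ R a u) ⟨
    - (- ω₁ R a u) ≈⟨ -‿cong (ω₁-flip v u (≡.sym ℓₒ≡) len≡ 1≤u) ⟨
    - ω₁ R a v     ∎

module _ {c ℓ} (R : CommutativeRing c ℓ) (a : CommutativeRing.Carrier R) (k : ℕ) where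
  open CommutativeRing R using (_≈_; -_)
  open Involution k
  open Weights R a

  ω₁-φ : ∀ {n λs} → InA (suc k) n λs → φ λs ≢ λs → ω₁ R a (φ λs) ≈ - ω₁ R a λs
  ω₁-φ {λs = λs} inA moved with φ-moved inA moved
  ... | ℓₒ≡ , adjacent =
    ω₁-adjacent (φ λs) λs ℓₒ≡ adjacent (InA-nonempty (φ-InA inA)) (InA-nonempty inA)

theorem8p2 : ∀ {c ℓ} (R : CommutativeRing c ℓ) (a : CommutativeRing.Carrier R)
    (m n : ℕ) → 1 ≤ m →
    (LA LB : List (List ℕ)) → Enumerates (InA m n) LA → Enumerates (InB m n) LB →
    CommutativeRing._≈_ R (ΣR R (map (ω₁ R a) LA)) (ΣR R (map (ω₂ R a) LB))
theorem8p2 R a (suc k) n (s≤s z≤n) LA LB enumA@(uniqueA , memA) enumB@(_ , memB) = begin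
    ΣR R (map (ω₁ R a) LA)                  ≈⟨ Σw-fixedPoints uniqueA (to (memA _)) φ-closed ⟩
    ΣR R (map (ω₁ R a) (filter fixed? LA))  ≈⟨ ΣR-↭ R (↭.map⁺ (ω₁ R a) (fixedPoints-↭ enumA enumB)) ⟩
    ΣR R (map (ω₁ R a) (map (_∷ʳ 0) LB))    ≡⟨ cong (ΣR R) (map-∘ LB) ⟨
    ΣR R (map (ω₁ R a ∘ (_∷ʳ 0)) LB)        ≈⟨ ΣR-map-cong R LB (ω₁-∷ʳ0 ∘ InB.odd ∘ to (memB _)) ⟩
    ΣR R (map (ω₂ R a) LB)                  ∎
  where
  open CommutativeRing R using (setoid)
  open import Relation.Binary.Reasoning.Setoid setoid
  open Equivalence
  open Involution k
  open Weights R a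
  open SignReversingInvolution R _≟L_ (InA (suc k) n) φ (ω₁ R a) φ-involutive (ω₁-φ R a k)

  φ-closed : ∀ {λs} → λs ∈ LA → φ λs ∈ LA
  φ-closed = from (memA _) ∘ φ-InA ∘ to (memA _)
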